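{- Let $p$ be an even positive integer, $\mu=\frac{p^2}{4}+2p+2$, $\gamma=2\mu-\left(\frac{p}{2}+4\right)$ and $S(p)=\langle \mu,\gamma,\gamma+1\rangle_{p\mu}$. Then the conductor of $S(p)$ is $p\mu$.
   Context: A numerical semigroup is a submonoid of $(\mathbb N,+)$ with finite complement. For integers $a_1,\dots,a_r$ and $t$, $\langle a_1,\dots,a_r\rangle_t$ denotes the smallest numerical semigroup containing $a_1,\dots,a_r$ and all integers $\ge t$. The conductor of a numerical semigroup $S$ is the smallest integer $c$ such that all integers $\ge c$ belong to $S$. -}

module Defs where

open import Data.Nat using (ℕ; zero; suc; _+_; _*_; _∸_; _≤_; _<_)
open import Data.Nat.DivMod using (_/_)
open import Data.List using (List)
open import Data.List.Membership.Propositional using (_∈_)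
open import Data.Product using (_×_)

-- ⟨ gens ⟩_t : the smallest submonoid of (ℕ,+) containing the generators
-- and every integer ≥ t (inductively generated closure).
data InGen (gens : List ℕ) (t : ℕ) : ℕ → Set where
  gen-zero : InGen gens t 0
  gen-elem : ∀ {a} → a ∈ gens → InGen gens t a
  gen-ge   : ∀ {n} → t ≤ n → InGen gens t n
  gen-add  : ∀ {m n} → InGen gens t m → InGen gens t n → InGen gens t (m + n)

IsConductor : (ℕ → Set) → ℕ → Set
IsConductor S c =
  (∀ n → c ≤ n → S n) × (∀ d → (∀ n → d ≤ n → S n) → c ≤ d)

-- μ = p²/4 + 2p + 2  (for even p, p²/4 = (p/2)²)
μ : ℕ → ℕ
μ p = (p / 2) * (p / 2) + 2 * p + 2

-- γ = 2μ − (p/2 + 4)   (nonnegative for p ≥ 0)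
γ : ℕ → ℕ
γ p = 2 * μ p ∸ (p / 2 + 4)

-- Write p = 2k, so μ = k² + 4k + 2 and γ = 2μ − (k + 4).  An element of ⟨μ, γ, γ + 1⟩ has the
-- form aμ + jγ + c with c ≤ j, and substituting jγ = 2jμ − j(k + 4) turns aμ + jγ + c = pμ − 1
-- into mμ + c + 1 = 2kμ + j(k + 4) with m = a + 2j.  If m ≤ 2k this leaves c + 1 ≥ j(k + 4),
-- forcing j = c = 0 and μ ∣ 1.  If m = 2k + 1 then j ≤ k and j(k + 4) < μ.  If m ≥ 2k + 2
-- then 2j ≤ m makes j(k + 4) smaller than (m − 2k)μ + c + 1.  Hence pμ − 1 is a gap, so pμ is
-- the conductor.
module Submission where

open import Defs
open import Data.Nat using (ℕ; _+_; _*_; _<_)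
open import Data.List using (_∷_; [])
open import Relation.Binary.PropositionalEquality using (_≡_)
open import Data.Product using (Σ)

open import Data.Nat using (zero; suc; pred; _∸_; _≤_; _≤?_; _≟_; z≤n; s≤s; z<s; NonZero; >-nonZero; s≤s⁻¹)
open import Data.Nat.Properties
open import Data.Nat.DivMod using (_/_; m*n/n≡m)
open import Data.Nat.Tactic.RingSolver using (solve)
open import Data.List.Membership.Propositional using (_∈_)
open import Data.List.Relation.Unary.Any using (here; there)
open import Data.Product using (_,_)
open import Function using (_∘_)
open import Data.Sum using (_⊎_; inj₁; inj₂)
open import Relation.Nullary using (¬_; yes; no; contradiction)
open import Relation.Binary.PropositionalEquality
  using (_≢_; refl; sym; trans; cong; subst; module ≡-Reasoning)

isConductor-after-gap : ∀ {S : ℕ → Set} {c} →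
  ¬ S (pred c) → (∀ n → c ≤ n → S n) → IsConductor S c
isConductor-after-gap {S} {c} gap full = full , minimal
  where
  minimal : ∀ d → (∀ n → d ≤ n → S n) → c ≤ d
  minimal d full-d with ≤-<-connex c d
  ... | inj₁ c≤d = c≤d
  ... | inj₂ d<c = contradiction (full-d (pred c) (<⇒≤pred d<c)) gap

-- a M + b G + c (G + 1) is recorded as a M + j G + c with j = b + c.
data Combination (M G : ℕ) : ℕ → Set where
  combination : ∀ a j c → c ≤ j → Combination M G (a * M + j * G + c)

combination-+ : ∀ {M G m n} →
  Combination M G m → Combination M G n → Combination M G (m + n)
combination-+ {M} {G} (combination a j c c≤j) (combination a′ j′ c′ c′≤j′) =
  subst (Combination M G) regroup
        (combination (a + a′) (j + j′) (c + c′) (+-mono-≤ c≤j c′≤j′))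
  where
  regroup : (a + a′) * M + (j + j′) * G + (c + c′) ≡ a * M + j * G + c + (a′ * M + j′ * G + c′)
  regroup = solve (a ∷ a′ ∷ j ∷ j′ ∷ c ∷ c′ ∷ M ∷ G ∷ [])

generator-combination : ∀ {M G x} → x ∈ M ∷ G ∷ G + 1 ∷ [] → Combination M G x
generator-combination {M} {G} (here refl) = subst (Combination M G) M≡ (combination 1 0 0 z≤n)
  where M≡ : 1 * M + 0 * G + 0 ≡ M
        M≡ = solve (M ∷ G ∷ [])
generator-combination {M} {G} (there (here refl)) = subst (Combination M G) G≡ (combination 0 1 0 z≤n)
  where G≡ : 0 * M + 1 * G + 0 ≡ G
        G≡ = solve (M ∷ G ∷ [])
generator-combination {M} {G} (there (there (here refl))) =
  subst (Combination M G) G+1≡ (combination 0 1 1 (s≤s z≤n))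
  where G+1≡ : 0 * M + 1 * G + 1 ≡ G + 1
        G+1≡ = solve (M ∷ G ∷ [])

InGen⇒≥⊎Combination : ∀ {M G t x} →
  InGen (M ∷ G ∷ G + 1 ∷ []) t x → t ≤ x ⊎ Combination M G x
InGen⇒≥⊎Combination gen-zero = inj₂ (combination 0 0 0 z≤n)
InGen⇒≥⊎Combination (gen-elem x∈gens) = inj₂ (generator-combination x∈gens)
InGen⇒≥⊎Combination (gen-ge t≤x) = inj₁ t≤x
InGen⇒≥⊎Combination (gen-add {m} {n} x y)
  with InGen⇒≥⊎Combination x | InGen⇒≥⊎Combination y
... | inj₁ t≤m | _        = inj₁ (≤-trans t≤m (m≤m+n m n))
... | inj₂ _   | inj₁ t≤n = inj₁ (≤-trans t≤n (m≤n+m n m))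
... | inj₂ cm  | inj₂ cn  = inj₂ (combination-+ cm cn)

substitute-G : ∀ {M G e a j c n} → G + e ≡ 2 * M →
  suc (a * M + j * G + c) ≡ n * M → (a + 2 * j) * M + suc c ≡ n * M + j * e
substitute-G {M} {G} {e} {a} {j} {c} {n} G+e≡2M eq = begin
  (a + 2 * j) * M + suc c       ≡⟨ solve (a ∷ j ∷ c ∷ M ∷ []) ⟩
  a * M + j * (2 * M) + suc c   ≡⟨ cong (λ z → a * M + j * z + suc c) (sym G+e≡2M) ⟩
  a * M + j * (G + e) + suc c   ≡⟨ solve (a ∷ j ∷ c ∷ M ∷ G ∷ e ∷ []) ⟩
  suc (a * M + j * G + c) + j * e ≡⟨ cong (_+ j * e) eq ⟩
  n * M + j * e                 ∎
  where open ≡-Reasoning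

reduced-impossible-≤ : ∀ {M e c j m n} → 2 ≤ M → 3 ≤ e → c ≤ j → m ≤ n →
  m * M + suc c ≢ n * M + j * e
reduced-impossible-≤ {M} {e} {c} {j} {m} {n} 2≤M 3≤e c≤j m≤n eq
  with n ∸ m | m+[n∸m]≡n m≤n
... | d | refl = small c≤j (+-cancelˡ-≡ (m * M) _ _ (trans eq (solve (m ∷ d ∷ M ∷ j ∷ e ∷ []))))
  where
  small : ∀ {j} → c ≤ j → suc c ≢ d * M + j * e
  small {zero} z≤n 1≡dM+0 =
    <⇒≢ 2≤M (sym (m*n≡1⇒n≡1 d M (trans (sym (+-identityʳ (d * M))) (sym 1≡dM+0))))
  small {suc i} c≤1+i 1+c≡ = n≮n (suc c) (begin-strict
    suc c             ≤⟨ s≤s c≤1+i ⟩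
    2 + i             <⟨ s≤s (s≤s (s≤s (m≤m*n i 3))) ⟩
    suc i * 3         ≤⟨ *-monoʳ-≤ (suc i) 3≤e ⟩
    suc i * e         ≤⟨ m≤n+m (suc i * e) (d * M) ⟩
    d * M + suc i * e ≡⟨ sym 1+c≡ ⟩
    suc c             ∎)
    where open ≤-Reasoning

reduced-impossible-1+2k : ∀ k {M c j} → M ≡ k * k + 4 * k + 2 → 2 * j ≤ 1 + 2 * k →
  (1 + 2 * k) * M + suc c ≢ 2 * k * M + j * (k + 4)
reduced-impossible-1+2k k {M} {c} {j} M≡ 2j≤1+2k eq = n≮n M (begin-strict
  M             <⟨ m<m+n M z<s ⟩
  M + suc c     ≡⟨ +-cancelˡ-≡ (2 * k * M) _ _ (trans regroup eq) ⟩
  j * (k + 4)   ≤⟨ *-monoˡ-≤ (k + 4) j≤k ⟩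
  k * (k + 4)   <⟨ m<m+n (k * (k + 4)) z<s ⟩
  k * (k + 4) + 2 ≡⟨ expand ⟩
  k * k + 4 * k + 2 ≡⟨ M≡ ⟨
  M             ∎)
  where
  open ≤-Reasoning
  regroup : 2 * k * M + (M + suc c) ≡ (1 + 2 * k) * M + suc c
  regroup = solve (k ∷ M ∷ c ∷ [])
  expand : k * (k + 4) + 2 ≡ k * k + 4 * k + 2
  expand = solve (k ∷ [])
  2+2k≡2*[1+k] : 2 + 2 * k ≡ 2 * suc k
  2+2k≡2*[1+k] = solve (k ∷ [])
  j≤k : j ≤ k
  j≤k = s≤s⁻¹ (*-cancelˡ-< 2 j (suc k) (subst (2 * j <_) 2+2k≡2*[1+k] (s≤s 2j≤1+2k)))

reduced-impossible-2+2k≤ : ∀ k {M c j m} → M ≡ k * k + 4 * k + 2 → 2 * j ≤ m → 2 + 2 * k ≤ m →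
  m * M + suc c ≢ 2 * k * M + j * (k + 4)
reduced-impossible-2+2k≤ k {M} {c} {j} {m} M≡ 2j≤m 2+2k≤m eq
  with m ∸ (2 + 2 * k) | m+[n∸m]≡n 2+2k≤m
... | d | refl = n≮n (2 * (m * M + suc c)) (begin-strict
  2 * (m * M + suc c)                  ≡⟨ cong (2 *_) eq ⟩
  2 * (2 * k * M + j * (k + 4))        ≡⟨ distribute ⟩
  2 * (2 * k * M) + 2 * j * (k + 4)    ≤⟨ +-monoʳ-≤ (2 * (2 * k * M)) (*-monoˡ-≤ (k + 4) 2j≤m) ⟩
  2 * (2 * k * M) + m * (k + 4)        <⟨ s≤s (m≤m+n _ _) ⟩
  suc (2 * (2 * k * M) + m * (k + 4) + (1 + 2 * k * k + 6 * k + d * (2 * k * k + 7 * k)))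
                                       ≡⟨ expand M≡ ⟨
  2 * (m * M + 1)                      ≤⟨ *-monoʳ-≤ 2 (+-monoʳ-≤ (m * M) (s≤s z≤n)) ⟩
  2 * (m * M + suc c)                  ∎)
  where
  open ≤-Reasoning
  distribute : 2 * (2 * k * M + j * (k + 4)) ≡ 2 * (2 * k * M) + 2 * j * (k + 4)
  distribute = solve (k ∷ M ∷ j ∷ [])
  expand : ∀ {M} → M ≡ k * k + 4 * k + 2 →
    2 * (m * M + 1) ≡ suc (2 * (2 * k * M) + m * (k + 4) + (1 + 2 * k * k + 6 * k + d * (2 * k * k + 7 * k)))
  expand refl = solve (k ∷ d ∷ [])

reduced-impossible : ∀ k {M c j m} → M ≡ k * k + 4 * k + 2 → c ≤ j → 2 * j ≤ m →
  m * M + suc c ≢ 2 * k * M + j * (k + 4)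
reduced-impossible k {M} {c} {j} {m} M≡ c≤j 2j≤m with m ≤? 2 * k
... | yes m≤2k = reduced-impossible-≤ 2≤M 3≤k+4 c≤j m≤2k
  where
  2≤M : 2 ≤ M
  2≤M = subst (2 ≤_) (sym M≡) (m≤n+m 2 (k * k + 4 * k))
  3≤k+4 : 3 ≤ k + 4
  3≤k+4 = ≤-trans (n≤1+n 3) (m≤n+m 4 k)
... | no m≰2k with m ≟ 1 + 2 * k
...   | yes refl  = reduced-impossible-1+2k k {j = j} M≡ 2j≤m
...   | no m≢1+2k =
    reduced-impossible-2+2k≤ k {j = j} M≡ 2j≤m (≤∧≢⇒< (≰⇒> m≰2k) (m≢1+2k ∘ sym))

suc-combination≢ : ∀ k {M G x} → M ≡ k * k + 4 * k + 2 → G + (k + 4) ≡ 2 * M →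
  Combination M G x → suc x ≢ 2 * k * M
suc-combination≢ k {M} {G} M≡ G+k+4≡2M (combination a j c c≤j) eq =
  reduced-impossible k M≡ c≤j (m≤n+m (2 * j) a)
    (substitute-G {M} {G} {k + 4} {a} {j} {c} {2 * k} G+k+4≡2M eq)

2*k/2≡k : ∀ k → 2 * k / 2 ≡ k
2*k/2≡k k = trans (cong (_/ 2) (*-comm 2 k)) (m*n/n≡m k 2)

μ-even : ∀ k → μ (2 * k) ≡ k * k + 4 * k + 2
μ-even k = begin
  μ (2 * k)                 ≡⟨ cong (λ h → h * h + 2 * (2 * k) + 2) (2*k/2≡k k) ⟩
  k * k + 2 * (2 * k) + 2   ≡⟨ solve (k ∷ []) ⟩
  k * k + 4 * k + 2         ∎
  where open ≡-Reasoning

γ-even : ∀ k → γ (2 * k) + (k + 4) ≡ 2 * μ (2 * k)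
γ-even k = begin
  γ (2 * k) + (k + 4)                 ≡⟨ cong (λ h → 2 * μ (2 * k) ∸ (h + 4) + (k + 4)) (2*k/2≡k k) ⟩
  2 * μ (2 * k) ∸ (k + 4) + (k + 4)   ≡⟨ m∸n+n≡m k+4≤2μ ⟩
  2 * μ (2 * k)                       ∎
  where
  open ≡-Reasoning
  2μ≡k+4+r : 2 * (k * k + 4 * k + 2) ≡ (k + 4) + (2 * k * k + 7 * k)
  2μ≡k+4+r = solve (k ∷ [])
  k+4≤2μ : k + 4 ≤ 2 * μ (2 * k)
  k+4≤2μ = subst (k + 4 ≤_) (sym (trans (cong (2 *_) (μ-even k)) 2μ≡k+4+r)) (m≤m+n (k + 4) _)

corollary3p9 : (p : ℕ) → 0 < p → Σ ℕ (λ k → p ≡ 2 * k) →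
    IsConductor (InGen (μ p ∷ γ p ∷ (γ p + 1) ∷ []) (p * μ p)) (p * μ p)
corollary3p9 p 0<p (k , refl) = isConductor-after-gap gap (λ _ → gen-ge)
  where
  M = μ (2 * k)
  t = 2 * k * M
  0<M : 0 < M
  0<M = subst (0 <_) (sym (μ-even k)) (≤-trans z<s (m≤n+m 2 (k * k + 4 * k)))
  instance
    t≢0 : NonZero t
    t≢0 = m*n≢0 (2 * k) M {{>-nonZero 0<p}} {{>-nonZero 0<M}}
  gap : ¬ InGen (M ∷ γ (2 * k) ∷ γ (2 * k) + 1 ∷ []) t (pred t)
  gap t-1∈S with InGen⇒≥⊎Combination t-1∈S
  ... | inj₁ t≤t-1 = n≮n t (m≤pred[n]⇒suc[m]≤n t≤t-1)
  ... | inj₂ comb  = suc-combination≢ k (μ-even k) (γ-even k) comb (suc-pred t)
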